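{- For all positive integers $n$, $M(n,1)\le \frac{1}{n}\left(2^{n+1}-2\right)$.
   Context: Let $\Sigma=\{0,1\}$. A grain pattern is a subset $E\subseteq\{2,\dots,n\}$ containing no two consecutive integers; $\mathcal{E}_{n,t}$ is the set of grain patterns with $|E|\le t$. For a grain pattern $E$, $\phi_E:\Sigma^n\to\Sigma^n$ maps $\mathbf{x}=(x_1,\dots,x_n)$ to $\mathbf{y}$ with $y_j=x_{j-1}$ if $j\in E$ and $y_j=x_j$ otherwise. $\Phi_t(\mathbf{x})=\{\phi_E(\mathbf{x}):E\in\mathcal{E}_{n,t}\}$. A code $C\subseteq\Sigma^n$ is $t$-grain-correcting if $\Phi_t(\mathbf{x}_1)\cap\Phi_t(\mathbf{x}_2)=\emptyset$ for all distinct $\mathbf{x}_1,\mathbf{x}_2\in C$. $M(n,t)$ is the maximum cardinality of a $t$-grain-correcting code of length $n$. -}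

module Defs where

open import Data.Bool using (Bool; true; false; if_then_else_)
open import Data.Nat using (ℕ; zero; suc; _+_; _≤_)
open import Data.Vec using (Vec; []; _∷_)
open import Data.List using (List)
open import Data.List.Membership.Propositional using (_∈_)
open import Data.Product using (∃₂; _×_)
open import Data.Empty using (⊥)
open import Data.Unit using (⊤)
open import Relation.Binary.PropositionalEquality using (_≡_; _≢_)
open import Relation.Nullary using (¬_)

-- Words over Σ = {0,1} of length n: Vec Bool n, entry i (0-based) = x_{i+1}.
Word : ℕ → Set
Word n = Vec Bool n

-- A subset E ⊆ {1,…,n} as its indicator vector (entry i ↔ position i+1).
Pattern : ℕ → Set
Pattern n = Vec Bool n

NoAdjacent : ∀ {n} → Pattern n → Set
NoAdjacent [] = ⊤
NoAdjacent (_ ∷ []) = ⊤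
NoAdjacent (true ∷ true ∷ _) = ⊥
NoAdjacent (true ∷ false ∷ es) = NoAdjacent (false ∷ es)
NoAdjacent (false ∷ e ∷ es) = NoAdjacent (e ∷ es)

FirstOut : ∀ {n} → Pattern n → Set
FirstOut [] = ⊤
FirstOut (e ∷ _) = e ≡ false

IsGrainPattern : ∀ {n} → Pattern n → Set
IsGrainPattern E = FirstOut E × NoAdjacent E

weight : ∀ {n} → Pattern n → ℕ
weight [] = 0
weight (true ∷ es) = suc (weight es)
weight (false ∷ es) = weight es

InE : (n t : ℕ) → Pattern n → Set
InE n t E = IsGrainPattern E × weight E ≤ t

φ-aux : ∀ {n} → Bool → Word n → Pattern n → Word n
φ-aux p [] [] = []
φ-aux p (x ∷ xs) (e ∷ es) = (if e then p else x) ∷ φ-aux x xs es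

-- φ_E(x): y_j = x_{j-1} if j ∈ E, y_j = x_j otherwise
-- (for j = 1 there is no x_0; grain patterns never contain 1, so y_1 = x_1)
φ : ∀ {n} → Pattern n → Word n → Word n
φ [] [] = []
φ (e ∷ es) (x ∷ xs) = x ∷ φ-aux x xs es

_∈Φ[_]_ : ∀ {n} → Word n → ℕ → Word n → Set
_∈Φ[_]_ {n} y t x = ∃ λ E → InE n t E × φ E x ≡ y
  where open import Data.Product using (∃)

DisjointΦ : ∀ {n} → ℕ → Word n → Word n → Set
DisjointΦ {n} t x₁ x₂ = ∀ (y : Word n) → y ∈Φ[ t ] x₁ → ¬ (y ∈Φ[ t ] x₂)

-- C ⊆ Σⁿ given as a duplicate-free list; t-grain-correcting
IsGrainCorrecting : ∀ {n} → ℕ → List (Word n) → Set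
IsGrainCorrecting t C =
  ∀ x₁ x₂ → x₁ ∈ C → x₂ ∈ C → x₁ ≢ x₂ → DisjointΦ t x₁ x₂

-- A word y with t transitions (indices j with y_{j-1} ≠ y_j) has exactly t + 1
-- words in Φ₁(y), and applying one grain never increases the number of transitions.
-- So if y gets mass 1/(t+1), every ball Φ₁(x) has mass at least 1.  The balls
-- around distinct codewords are disjoint, hence |C| is at most the mass of Σⁿ,
-- which is 2 Σ_j C(n-1,j)/(j+1) = (2^{n+1} − 2)/n.  Masses are scaled by n! to
-- stay in ℕ.
module Submission where

open import Defs
open import Data.Nat using (ℕ; suc; _*_; _∸_; _^_; _≤_)
open import Data.List using (List; length)
open import Data.List.Relation.Unary.Unique.Propositional using (Unique)

open import Function using (_∘_)
open import Data.Bool using (Bool; true; false)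
open import Data.Nat using (zero; _+_; _<_; _!; z≤n; s≤s; NonZero)
open import Data.Nat.DivMod using (_/_; m*[n/m]≡n; /-monoʳ-≤)
open import Data.Nat.Divisibility using (_∣_; m∣m*n; ∣-trans; m≤n⇒m!∣n!)
open import Data.Nat.Properties
open import Algebra.Properties.CommutativeSemigroup +-commutativeSemigroup using (interchange; xy∙z≈xz∙y)
open import Data.Nat.Tactic.RingSolver using (solve-∀)
open import Data.Nat.ListAction using (sum)
open import Data.Nat.ListAction.Properties using (sum-++; sum-↭)
open import Data.Vec using (Vec; []; _∷_; head; replicate)
open import Data.List using ([]; _∷_; _++_; [_]; map; concatMap)
open import Data.List.Properties using (map-++; map-∘; length-++; length-map)
open import Data.List.Membership.Propositional using (_∈_; find)
open import Data.List.Membership.Propositional.Properties using (∈-∃++; ∈-++⁺ˡ; ∈-++⁺ʳ; ∈-++⁻; ∈-map⁺; ∈-map⁻; ∈-concatMap⁻)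
open import Data.List.Relation.Unary.Any using (here; there)
open import Data.List.Relation.Unary.All using ([]; _∷_)
import Data.List.Relation.Unary.All as All
open import Data.List.Relation.Unary.AllPairs using ([]; _∷_)
open import Data.List.Relation.Unary.Unique.Propositional.Properties using (++⁺) renaming (map⁺ to Unique-map⁺)
open import Data.List.Relation.Binary.Subset.Propositional using (_⊆_)
open import Data.List.Relation.Binary.Permutation.Propositional using (_↭_; ↭-refl; ↭-trans; ↭-prep)
open import Data.List.Relation.Binary.Permutation.Propositional.Properties
  using (∈-resp-↭; shift) renaming (map⁺ to ↭-map⁺)
open import Data.Product using (_,_; _×_; ∃)
open import Data.Sum using (inj₁; inj₂)
open import Data.Unit using (tt)
open import Data.Empty using (⊥-elim)
open import Relation.Binary.PropositionalEquality using (_≡_; refl; sym; trans; cong; cong₂; module ≡-Reasoning)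
open import Relation.Nullary using (¬_)

module _ {A : Set} where

  ∈⇒↭∷ : ∀ {x : A} {xs} → x ∈ xs → ∃ λ ys → xs ↭ x ∷ ys
  ∈⇒↭∷ x∈xs with ys , zs , refl ← ∈-∃++ x∈xs = ys ++ zs , shift _ ys zs

  Unique-⊆⇒↭++ : ∀ {xs ys : List A} → Unique xs → xs ⊆ ys → ∃ λ zs → ys ↭ xs ++ zs
  Unique-⊆⇒↭++ {[]} {ys} [] _ = ys , ↭-refl
  Unique-⊆⇒↭++ {x ∷ xs} (x∉xs ∷ xs!) xs⊆ys
    with ys′ , ys↭x∷ys′ ← ∈⇒↭∷ (xs⊆ys (here refl)) =
    let zs , ys′↭xs++zs = Unique-⊆⇒↭++ xs! xs⊆ys′ in
    zs , ↭-trans ys↭x∷ys′ (↭-prep x ys′↭xs++zs)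
    where
    xs⊆ys′ : xs ⊆ ys′
    xs⊆ys′ v∈xs with ∈-resp-↭ ys↭x∷ys′ (xs⊆ys (there v∈xs))
    ... | here refl = ⊥-elim (All.lookup x∉xs v∈xs refl)
    ... | there v∈ys′ = v∈ys′

  sum-map-mono-⊆ : ∀ (f : A → ℕ) {xs ys} → Unique xs → xs ⊆ ys →
                   sum (map f xs) ≤ sum (map f ys)
  sum-map-mono-⊆ f {xs} {ys} xs! xs⊆ys with zs , ys↭xs++zs ← Unique-⊆⇒↭++ xs! xs⊆ys = begin
    sum (map f xs)                    ≤⟨ m≤m+n _ _ ⟩
    sum (map f xs) + sum (map f zs)   ≡⟨ sum-++ (map f xs) (map f zs) ⟨
    sum (map f xs ++ map f zs)        ≡⟨ cong sum (map-++ f xs zs) ⟨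
    sum (map f (xs ++ zs))            ≡⟨ sum-↭ (↭-map⁺ f ys↭xs++zs) ⟨
    sum (map f ys)                    ∎
    where open ≤-Reasoning

  length*≤sum-map-concatMap : ∀ (f : A → ℕ) (g : A → List A) c xs → (∀ x → c ≤ sum (map f (g x))) →
                              length xs * c ≤ sum (map f (concatMap g xs))
  length*≤sum-map-concatMap f g c []       _      = z≤n
  length*≤sum-map-concatMap f g c (x ∷ xs) c≤sum = begin
    c + length xs * c                                    ≤⟨ +-mono-≤ (c≤sum x) (length*≤sum-map-concatMap f g c xs c≤sum) ⟩
    sum (map f (g x)) + sum (map f (concatMap g xs))     ≡⟨ sum-++ (map f (g x)) _ ⟨
    sum (map f (g x) ++ map f (concatMap g xs))          ≡⟨ cong sum (map-++ f (g x) (concatMap g xs)) ⟨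
    sum (map f (concatMap g (x ∷ xs)))                   ∎
    where open ≤-Reasoning

  length*≤sum-map : ∀ (f : A → ℕ) c {xs} → (∀ {x} → x ∈ xs → c ≤ f x) → length xs * c ≤ sum (map f xs)
  length*≤sum-map f c {[]} _ = z≤n
  length*≤sum-map f c {x ∷ xs} c≤f = +-mono-≤ (c≤f (here refl)) (length*≤sum-map f c (c≤f ∘ there))

change : Bool → Bool → ℕ
change false false = 0
change false true  = 1
change true  false = 1
change true  true  = 0

change-self : ∀ a → change a a ≡ 0
change-self false = refl
change-self true  = refl

change≤1 : ∀ a b → change a b ≤ 1
change≤1 false false = z≤n
change≤1 false true  = ≤-refl
change≤1 true  false = ≤-refl
change≤1 true  true  = z≤n

transitions : ∀ {n} → Word n → ℕ
transitions []           = 0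
transitions (_ ∷ [])     = 0
transitions (a ∷ b ∷ xs) = change a b + transitions (b ∷ xs)

transitions≤length : ∀ {k} (x : Word (suc k)) → transitions x ≤ k
transitions≤length (a ∷ [])     = z≤n
transitions≤length (a ∷ b ∷ xs) = +-mono-≤ (change≤1 a b) (transitions≤length (b ∷ xs))

transitions-changeHead : ∀ {k} a b (xs : Vec Bool k) → transitions (a ∷ xs) ≤ suc (transitions (b ∷ xs))
transitions-changeHead a b []       = z≤n
transitions-changeHead a b (c ∷ xs) =
  +-mono-≤ (change≤1 a c) (m≤n+m (transitions (c ∷ xs)) (change b c))

secondGrain : ∀ {k} → Bool → Bool → Vec Bool k → List (Word (suc (suc k)))
secondGrain false false xs = []
secondGrain false true  xs = [ false ∷ false ∷ xs ]
secondGrain true  false xs = [ true ∷ true ∷ xs ]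
secondGrain true  true  xs = []

-- The distinct words of Φ₁(x): x itself and, for every j with x_{j-1} ≠ x_j,
-- x with its j-th letter overwritten by x_{j-1}.
ball : ∀ {k} → Word (suc k) → List (Word (suc k))
ball (a ∷ [])     = [ a ∷ [] ]
ball (a ∷ b ∷ xs) = secondGrain a b xs ++ map (a ∷_) (ball (b ∷ xs))

∈-secondGrain⁻ : ∀ {k} a b (xs : Vec Bool k) {y} → y ∈ secondGrain a b xs →
                 change a b ≡ 1 × y ≡ a ∷ a ∷ xs
∈-secondGrain⁻ false true  xs (here refl) = refl , refl
∈-secondGrain⁻ true  false xs (here refl) = refl , refl

length-secondGrain : ∀ {k} a b (xs : Vec Bool k) → length (secondGrain a b xs) ≡ change a b
length-secondGrain false false xs = refl
length-secondGrain false true  xs = refl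
length-secondGrain true  false xs = refl
length-secondGrain true  true  xs = refl

Unique-secondGrain : ∀ {k} a b (xs : Vec Bool k) → Unique (secondGrain a b xs)
Unique-secondGrain false false xs = []
Unique-secondGrain false true  xs = [] ∷ []
Unique-secondGrain true  false xs = [] ∷ []
Unique-secondGrain true  true  xs = []

head-ball : ∀ {k} (x : Word (suc k)) {y} → y ∈ ball x → head y ≡ head x
head-ball (a ∷ [])     (here refl) = refl
head-ball (a ∷ b ∷ xs) y∈ball with ∈-++⁻ (secondGrain a b xs) y∈ball
... | inj₁ y∈grain with _ , refl ← ∈-secondGrain⁻ a b xs y∈grain = refl
... | inj₂ y∈rest  with _ , _ , refl ← ∈-map⁻ (a ∷_) y∈rest = refl

length-ball : ∀ {k} (x : Word (suc k)) → length (ball x) ≡ suc (transitions x)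
length-ball (a ∷ [])     = refl
length-ball (a ∷ b ∷ xs) = begin
  length (secondGrain a b xs ++ map (a ∷_) (ball (b ∷ xs)))
    ≡⟨ length-++ (secondGrain a b xs) ⟩
  length (secondGrain a b xs) + length (map (a ∷_) (ball (b ∷ xs)))
    ≡⟨ cong₂ _+_ (length-secondGrain a b xs) (trans (length-map (a ∷_) (ball (b ∷ xs))) (length-ball (b ∷ xs))) ⟩
  change a b + suc (transitions (b ∷ xs))
    ≡⟨ +-suc (change a b) _ ⟩
  suc (transitions (a ∷ b ∷ xs)) ∎
  where open ≡-Reasoning

Unique-ball : ∀ {k} (x : Word (suc k)) → Unique (ball x)
Unique-ball (a ∷ [])     = [] ∷ []
Unique-ball (a ∷ b ∷ xs) =
  ++⁺ (Unique-secondGrain a b xs) (Unique-map⁺ ∷-injectiveʳ (Unique-ball (b ∷ xs))) disjoint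
  where
  ∷-injectiveʳ : ∀ {u v : Word (suc _)} → _≡_ {A = Word _} (a ∷ u) (a ∷ v) → u ≡ v
  ∷-injectiveʳ refl = refl
  -- words of the first list have second letter a ≠ b, those of the second list have second letter b
  disjoint : ∀ {y} → ¬ (y ∈ secondGrain a b xs × y ∈ map (a ∷_) (ball (b ∷ xs)))
  disjoint (y∈grain , y∈rest) with change≡1 , refl ← ∈-secondGrain⁻ a b xs y∈grain
                               | z , z∈ball , refl ← ∈-map⁻ (a ∷_) y∈rest
    with refl ← head-ball (b ∷ xs) z∈ball = 0≢1+n (trans (sym (change-self a)) change≡1)

transitions-ball : ∀ {k} (x : Word (suc k)) {y} → y ∈ ball x → transitions y ≤ transitions x
transitions-ball (a ∷ [])     (here refl) = z≤n
transitions-ball (a ∷ b ∷ xs) y∈ball with ∈-++⁻ (secondGrain a b xs) y∈ball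
... | inj₁ y∈grain with change≡1 , refl ← ∈-secondGrain⁻ a b xs y∈grain
  rewrite change-self a | change≡1 = transitions-changeHead a b xs
... | inj₂ y∈rest with (c ∷ zs) , z∈ball , refl ← ∈-map⁻ (a ∷_) y∈rest
                  with refl ← head-ball (b ∷ xs) z∈ball =
  +-monoʳ-≤ (change a b) (transitions-ball (b ∷ xs) z∈ball)

φ-aux-replicate-false : ∀ {k} p (xs : Vec Bool k) → φ-aux p xs (replicate k false) ≡ xs
φ-aux-replicate-false p []       = refl
φ-aux-replicate-false p (x ∷ xs) = cong (x ∷_) (φ-aux-replicate-false x xs)

weight-replicate-false : ∀ k → weight (replicate k false) ≡ 0
weight-replicate-false zero    = refl
weight-replicate-false (suc k) = weight-replicate-false k

NoAdjacent-∷-replicate-false : ∀ e k → NoAdjacent (e ∷ replicate k false)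
NoAdjacent-∷-replicate-false e     zero    = tt
NoAdjacent-∷-replicate-false false (suc k) = NoAdjacent-∷-replicate-false false k
NoAdjacent-∷-replicate-false true  (suc k) = NoAdjacent-∷-replicate-false false k

grain₂∈Φ₁ : ∀ {k} a b (xs : Vec Bool k) → (a ∷ a ∷ xs) ∈Φ[ 1 ] (a ∷ b ∷ xs)
grain₂∈Φ₁ {k} a b xs =
  false ∷ true ∷ replicate k false ,
  ((refl , NoAdjacent-∷-replicate-false true k) , s≤s (≤-reflexive (weight-replicate-false k))) ,
  cong (λ zs → a ∷ a ∷ zs) (φ-aux-replicate-false b xs)

∷-∈Φ₁ : ∀ {k} a b (xs : Vec Bool k) {z} → z ∈Φ[ 1 ] (b ∷ xs) → (a ∷ z) ∈Φ[ 1 ] (a ∷ b ∷ xs)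
∷-∈Φ₁ a b xs (e ∷ es , ((refl , noAdjacent) , weight≤1) , refl) =
  false ∷ false ∷ es , ((refl , noAdjacent) , weight≤1) , refl

ball⊆Φ₁ : ∀ {k} (x : Word (suc k)) {y} → y ∈ ball x → y ∈Φ[ 1 ] x
ball⊆Φ₁ (a ∷ [])     (here refl) = false ∷ [] , ((refl , tt) , z≤n) , refl
ball⊆Φ₁ (a ∷ b ∷ xs) y∈ball with ∈-++⁻ (secondGrain a b xs) y∈ball
... | inj₁ y∈grain with _ , refl ← ∈-secondGrain⁻ a b xs y∈grain = grain₂∈Φ₁ a b xs
... | inj₂ y∈rest  with _ , z∈ball , refl ← ∈-map⁻ (a ∷_) y∈rest = ∷-∈Φ₁ a b xs (ball⊆Φ₁ (b ∷ xs) z∈ball)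

Unique-concatMap-ball : ∀ {k} {C : List (Word (suc k))} → Unique C → IsGrainCorrecting 1 C →
                        Unique (concatMap ball C)
Unique-concatMap-ball {C = []}    []          _          = []
Unique-concatMap-ball {C = x ∷ C} (x∉C ∷ C!) correcting =
  ++⁺ (Unique-ball x) (Unique-concatMap-ball C! (λ x₁ x₂ x₁∈C x₂∈C → correcting x₁ x₂ (there x₁∈C) (there x₂∈C))) disjoint
  where
  disjoint : ∀ {y} → ¬ (y ∈ ball x × y ∈ concatMap ball C)
  disjoint {y} (y∈ball , y∈balls) with x′ , x′∈C , y∈ball′ ← find (∈-concatMap⁻ ball y∈balls) =
    correcting x x′ (here refl) (there x′∈C) (All.lookup x∉C x′∈C) y (ball⊆Φ₁ x y∈ball) (ball⊆Φ₁ x′ y∈ball′)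

allWords : ∀ n → List (Word n)
allWords zero    = [ [] ]
allWords (suc n) = map (false ∷_) (allWords n) ++ map (true ∷_) (allWords n)

∈-allWords : ∀ {n} (x : Word n) → x ∈ allWords n
∈-allWords []                 = here refl
∈-allWords (false ∷ x)        = ∈-++⁺ˡ (∈-map⁺ (false ∷_) (∈-allWords x))
∈-allWords {suc n} (true ∷ x) = ∈-++⁺ʳ (map (false ∷_) (allWords n)) (∈-map⁺ (true ∷_) (∈-allWords x))

sum-map-allWords-suc : ∀ n (f : Word (suc n) → ℕ) →
  sum (map f (allWords (suc n))) ≡ sum (map (f ∘ (false ∷_)) (allWords n)) + sum (map (f ∘ (true ∷_)) (allWords n))
sum-map-allWords-suc n f = begin
  sum (map f (map (false ∷_) words ++ map (true ∷_) words))
    ≡⟨ cong sum (map-++ f (map (false ∷_) words) (map (true ∷_) words)) ⟩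
  sum (map f (map (false ∷_) words) ++ map f (map (true ∷_) words))
    ≡⟨ sum-++ (map f (map (false ∷_) words)) (map f (map (true ∷_) words)) ⟩
  sum (map f (map (false ∷_) words)) + sum (map f (map (true ∷_) words))
    ≡⟨ cong₂ _+_ (cong sum (map-∘ words)) (cong sum (map-∘ words)) ⟨
  sum (map (f ∘ (false ∷_)) words) + sum (map (f ∘ (true ∷_)) words) ∎
  where
  open ≡-Reasoning
  words : List (Word n)
  words = allWords n

-- binomialSum m f = Σ_{j ≤ m} (m choose j) · f j, unfolded by Pascal's rule.
binomialSum : ℕ → (ℕ → ℕ) → ℕ
binomialSum zero    f = f 0
binomialSum (suc m) f = binomialSum m f + binomialSum m (f ∘ suc)

binomialSum-cong : ∀ m {f g} → (∀ j → j ≤ m → f j ≡ g j) → binomialSum m f ≡ binomialSum m g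
binomialSum-cong zero    f≗g = f≗g 0 z≤n
binomialSum-cong (suc m) f≗g = cong₂ _+_
  (binomialSum-cong m (λ j j≤m → f≗g j (m≤n⇒m≤1+n j≤m)))
  (binomialSum-cong m (λ j j≤m → f≗g (suc j) (s≤s j≤m)))

binomialSum-+ : ∀ m f g → binomialSum m (λ j → f j + g j) ≡ binomialSum m f + binomialSum m g
binomialSum-+ zero    f g = refl
binomialSum-+ (suc m) f g = trans
  (cong₂ _+_ (binomialSum-+ m f g) (binomialSum-+ m (f ∘ suc) (g ∘ suc)))
  (interchange (binomialSum m f) _ _ _)

binomialSum-const : ∀ m c → binomialSum m (λ _ → c) ≡ 2 ^ m * c
binomialSum-const zero    c = sym (*-identityˡ c)
binomialSum-const (suc m) c = trans (cong₂ _+_ (binomialSum-const m c) (binomialSum-const m c)) (double (2 ^ m) c)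
  where
  double : ∀ p c → p * c + p * c ≡ 2 * p * c
  double = solve-∀

binomialSum-head : ∀ m {f g} → (∀ j → j < m → f (suc j) ≡ g (suc j)) →
                   binomialSum m f + g 0 ≡ binomialSum m g + f 0
binomialSum-head zero    {f} {g} _    = +-comm (f 0) (g 0)
binomialSum-head (suc m) {f} {g} f≗g = begin
  binomialSum m f + binomialSum m (f ∘ suc) + g 0   ≡⟨ xy∙z≈xz∙y (binomialSum m f) _ _ ⟩
  binomialSum m f + g 0 + binomialSum m (f ∘ suc)   ≡⟨ cong₂ _+_ (binomialSum-head m (λ j j<m → f≗g j (m<n⇒m<1+n j<m)))
                                                                 (binomialSum-cong m (λ j j≤m → f≗g j (s≤s j≤m))) ⟩
  binomialSum m g + f 0 + binomialSum m (g ∘ suc)   ≡⟨ xy∙z≈xz∙y (binomialSum m g) _ _ ⟩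
  binomialSum m g + binomialSum m (g ∘ suc) + f 0   ∎
  where open ≡-Reasoning

-- The coefficients of binomialSum (suc m) (absorbed a) are i·C(m+1,i) = (m+1)·C(m,i-1).
absorbed : (ℕ → ℕ) → ℕ → ℕ
absorbed a zero    = 0
absorbed a (suc j) = suc j * a j

binomialSum-absorption : ∀ m a → binomialSum (suc m) (absorbed a) ≡ suc m * binomialSum m a
binomialSum-absorption zero    a = refl
binomialSum-absorption (suc m) a = begin
  binomialSum (suc m) (absorbed a) + binomialSum (suc m) (λ j → a j + j * a j)
    ≡⟨ cong₂ _+_ (binomialSum-absorption m a) (binomialSum-+ (suc m) a (λ j → j * a j)) ⟩
  suc m * B a + (binomialSum (suc m) a + binomialSum (suc m) (λ j → j * a j))
    ≡⟨ cong (λ t → suc m * B a + (binomialSum (suc m) a + t)) j*a≡absorbed ⟩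
  suc m * B a + ((B a + B (a ∘ suc)) + suc m * B (a ∘ suc))
    ≡⟨ collect (suc m) (B a) (B (a ∘ suc)) ⟩
  suc (suc m) * (B a + B (a ∘ suc)) ∎
  where
  open ≡-Reasoning
  B : (ℕ → ℕ) → ℕ
  B = binomialSum m
  j*a≡absorbed : binomialSum (suc m) (λ j → j * a j) ≡ suc m * B (a ∘ suc)
  j*a≡absorbed = trans (binomialSum-cong (suc m) λ { zero _ → refl ; (suc j) _ → refl })
                       (binomialSum-absorption m (a ∘ suc))
  collect : ∀ k x y → k * x + ((x + y) + k * y) ≡ suc k * (x + y)
  collect = solve-∀

sum-transitions-∷ : ∀ m b (g : ℕ → ℕ) →
                    sum (map (g ∘ transitions ∘ (b ∷_)) (allWords m)) ≡ binomialSum m g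
sum-transitions-∷ zero    b g = +-identityʳ (g 0)
sum-transitions-∷ (suc m) b g = begin
  sum (map (g ∘ transitions ∘ (b ∷_)) (allWords (suc m)))
    ≡⟨ sum-map-allWords-suc m (g ∘ transitions ∘ (b ∷_)) ⟩
  sum (map (g ∘ (change b false +_) ∘ transitions ∘ (false ∷_)) (allWords m)) +
  sum (map (g ∘ (change b true  +_) ∘ transitions ∘ (true  ∷_)) (allWords m))
    ≡⟨ cong₂ _+_ (sum-transitions-∷ m false _) (sum-transitions-∷ m true _) ⟩
  binomialSum m (g ∘ (change b false +_)) + binomialSum m (g ∘ (change b true +_))
    ≡⟨ pascal b ⟩
  binomialSum (suc m) g ∎
  where
  open ≡-Reasoning
  pascal : ∀ b → binomialSum m (g ∘ (change b false +_)) + binomialSum m (g ∘ (change b true +_))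
                 ≡ binomialSum (suc m) g
  pascal false = refl
  pascal true  = +-comm (binomialSum m (g ∘ suc)) (binomialSum m g)

sum-transitions : ∀ m (g : ℕ → ℕ) →
                  sum (map (g ∘ transitions) (allWords (suc m))) ≡ binomialSum m g + binomialSum m g
sum-transitions m g = trans (sum-map-allWords-suc m (g ∘ transitions))
                            (cong₂ _+_ (sum-transitions-∷ m false g) (sum-transitions-∷ m true g))

m<n⇒1+m∣n! : ∀ {j n} → j < n → suc j ∣ n !
m<n⇒1+m∣n! j<n = ∣-trans (m∣m*n _) (m≤n⇒m!∣n! j<n)

module WeightedCount (m : ℕ) where

  D : ℕ
  D = suc m !

  instance
    D≢0 : NonZero D
    D≢0 = suc m !≢0

  share : ℕ → ℕ
  share j = D / suc j

  suc*share : ∀ {j} → j ≤ m → suc j * share j ≡ D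
  suc*share j≤m = m*[n/m]≡n (m<n⇒1+m∣n! (s≤s j≤m))

  mass : Word (suc m) → ℕ
  mass = share ∘ transitions

  D≤mass-ball : ∀ x → D ≤ sum (map mass (ball x))
  D≤mass-ball x = begin
    D                                           ≡⟨ suc*share (transitions≤length x) ⟨
    suc (transitions x) * share (transitions x) ≡⟨ cong (_* share (transitions x)) (length-ball x) ⟨
    length (ball x) * share (transitions x)     ≤⟨ length*≤sum-map mass _ share-mono ⟩
    sum (map mass (ball x))                     ∎
    where
    open ≤-Reasoning
    share-mono : ∀ {y} → y ∈ ball x → share (transitions x) ≤ mass y
    share-mono y∈ball = /-monoʳ-≤ D (s≤s (transitions-ball x y∈ball))

  -- the mass of the words with a prescribed first letter
  H : ℕ
  H = binomialSum m share

  suc*H+D : suc m * H + D ≡ 2 ^ suc m * D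
  suc*H+D = begin
    suc m * H + D                            ≡⟨ cong (_+ D) (binomialSum-absorption m share) ⟨
    binomialSum (suc m) (absorbed share) + D ≡⟨ binomialSum-head (suc m) (λ j j<1+m → suc*share (≤-pred j<1+m)) ⟩
    binomialSum (suc m) (λ _ → D) + 0        ≡⟨ +-identityʳ _ ⟩
    binomialSum (suc m) (λ _ → D)            ≡⟨ binomialSum-const (suc m) D ⟩
    2 ^ suc m * D                            ∎
    where open ≡-Reasoning

  length*D≤H+H : (C : List (Word (suc m))) → Unique C → IsGrainCorrecting 1 C → length C * D ≤ H + H
  length*D≤H+H C C! correcting = begin
    length C * D                      ≤⟨ length*≤sum-map-concatMap mass ball D C D≤mass-ball ⟩
    sum (map mass (concatMap ball C)) ≤⟨ sum-map-mono-⊆ mass (Unique-concatMap-ball C! correcting) (λ {y} _ → ∈-allWords y) ⟩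
    sum (map mass (allWords (suc m))) ≡⟨ sum-transitions m share ⟩
    H + H                             ∎
    where open ≤-Reasoning

  suc*[H+H]≡bound*D : suc m * (H + H) ≡ (2 ^ suc (suc m) ∸ 2) * D
  suc*[H+H]≡bound*D = begin
    suc m * (H + H)                 ≡⟨ double-distrib (suc m) H ⟩
    2 * (suc m * H)                 ≡⟨ m+n∸n≡m _ (2 * D) ⟨
    2 * (suc m * H) + 2 * D ∸ 2 * D ≡⟨ cong (_∸ 2 * D) (*-distribˡ-+ 2 (suc m * H) D) ⟨
    2 * (suc m * H + D) ∸ 2 * D     ≡⟨ cong (λ t → 2 * t ∸ 2 * D) suc*H+D ⟩
    2 * (2 ^ suc m * D) ∸ 2 * D     ≡⟨ cong (_∸ 2 * D) (*-assoc 2 (2 ^ suc m) D) ⟨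
    2 ^ suc (suc m) * D ∸ 2 * D     ≡⟨ *-distribʳ-∸ D (2 ^ suc (suc m)) 2 ⟨
    (2 ^ suc (suc m) ∸ 2) * D       ∎
    where
    open ≡-Reasoning
    double-distrib : ∀ k t → k * (t + t) ≡ 2 * (k * t)
    double-distrib = solve-∀

corollary3p3 : ∀ (n : ℕ) → 1 ≤ n → (C : List (Word n)) → Unique C →
    IsGrainCorrecting 1 C → n * length C ≤ 2 ^ suc n ∸ 2
corollary3p3 (suc m) _ C C! correcting = *-cancelʳ-≤ (suc m * length C) (2 ^ suc (suc m) ∸ 2) D (begin
  suc m * length C * D      ≡⟨ *-assoc (suc m) (length C) D ⟩
  suc m * (length C * D)    ≤⟨ *-monoʳ-≤ (suc m) (length*D≤H+H C C! correcting) ⟩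
  suc m * (H + H)           ≡⟨ suc*[H+H]≡bound*D ⟩
  (2 ^ suc (suc m) ∸ 2) * D ∎)
  where
  open WeightedCount m
  open ≤-Reasoning
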